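{- Consider a uniformly random restricted pairing in $\mathcal{M}(L,R,{\bf d})$ and let $I$ be the number of double loops in it. Then ${\bf E}(I)=O(d_{\max}^3/M)$ as $n\to\infty$.
   Context: Setting: $L,R$ partition $[n]$, ${\bf d}=(d_1,\dots,d_n)$ nonnegative integers with $M=\sum_i d_i$ even, $d_{\max}=\max_i d_i$, $M_1(S)=\sum_{i\in S}d_i$, and standing assumption $M_1(R)\ge M_1(L)$; asymptotics as $n\to\infty$ with $M\to\infty$. Pairing model: vertex $i$ is a bucket with $d_i$ points; a pairing is a perfect matching of all $M$ points; it is restricted if no pair has both points in buckets of vertices in $L$; $\mathcal{M}(L,R,{\bf d})$ is the uniformly distributed set of restricted pairings. A loop is a pair whose two points lie in the same vertex; a double loop is a set of two loops at a common vertex. -}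

module Defs where

open import Data.Bool using (Bool; true; false; _∧_; not; if_then_else_)
open import Data.Nat using (ℕ; zero; suc; _+_; _*_; _⊔_; _/_)
open import Data.Nat.Combinatorics using (_C_)
open import Data.Fin using (Fin; _≟_)
open import Data.List using (List; []; _∷_; map; concatMap; replicate; length; filter; lookup; allFin)
open import Data.Bool.ListAction using (and)
open import Data.Nat.ListAction using (sum)
open import Data.Bool using (T?)
open import Data.Vec using (Vec) renaming ([] to []ᵥ; _∷_ to _∷ᵥ_; lookup to lookupᵥ)
open import Relation.Nullary.Decidable using (⌊_⌋)

-- Degree sequence d : Fin n → ℕ ; L given by its indicator inL : Fin n → Bool
-- (R is the complement of L).

Σv : {n : ℕ} → (Fin n → ℕ) → ℕ
Σv {n} f = sum (map f (allFin n))

totalDeg : {n : ℕ} → (Fin n → ℕ) → ℕ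
totalDeg d = Σv d

M1 : {n : ℕ} → (Fin n → Bool) → (Fin n → ℕ) → ℕ
M1 S d = Σv (λ i → if S i then d i else 0)

dmax : {n : ℕ} → (Fin n → ℕ) → ℕ
dmax {n} d = Data.List.foldr _⊔_ 0 (map d (allFin n))

-- Points: bucket of vertex i contains d_i points; points are listed
-- bucket by bucket, and owner p is the vertex whose bucket contains p.
ownerList : {n : ℕ} → (Fin n → ℕ) → List (Fin n)
ownerList {n} d = concatMap (λ v → replicate (d v) v) (allFin n)

Point : {n : ℕ} → (Fin n → ℕ) → Set
Point d = Fin (length (ownerList d))

owner : {n : ℕ} (d : Fin n → ℕ) → Point d → Fin n
owner d p = lookup (ownerList d) p

allVecs : (m k : ℕ) → List (Vec (Fin m) k)
allVecs m zero = []ᵥ ∷ []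
allVecs m (suc k) = concatMap (λ x → map (x ∷ᵥ_) (allVecs m k)) (allFin m)

allMaps : {n : ℕ} (d : Fin n → ℕ) → List (Point d → Point d)
allMaps d = map lookupᵥ (allVecs (length (ownerList d)) (length (ownerList d)))

-- f is a pairing (perfect matching of the points): a fixed-point-free involution
isPairing : {n : ℕ} (d : Fin n → ℕ) → (Point d → Point d) → Bool
isPairing d f = and (map (λ p → not ⌊ f p ≟ p ⌋ ∧ ⌊ f (f p) ≟ p ⌋) (allFin _))

isRestricted : {n : ℕ} (inL : Fin n → Bool) (d : Fin n → ℕ) → (Point d → Point d) → Bool
isRestricted inL d f = and (map (λ p → not (inL (owner d p) ∧ inL (owner d (f p)))) (allFin _))

restrictedPairings : {n : ℕ} (inL : Fin n → Bool) (d : Fin n → ℕ) → List (Point d → Point d)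
restrictedPairings inL d =
  filter (λ f → T? (isPairing d f ∧ isRestricted inL d f)) (allMaps d)

-- number of loops at vertex v: points p in v with f p in v, divided by 2
-- (each loop is a pair {p, f p} counted twice)
loopsAt : {n : ℕ} (d : Fin n → ℕ) → (Point d → Point d) → Fin n → ℕ
loopsAt d f v =
  sum (map (λ p → if ⌊ owner d p ≟ v ⌋ ∧ ⌊ owner d (f p) ≟ v ⌋ then 1 else 0) (allFin _)) / 2

doubleLoops : {n : ℕ} (d : Fin n → ℕ) → (Point d → Point d) → ℕ
doubleLoops d f = Σv (λ v → loopsAt d f v C 2)

numRestricted : {n : ℕ} (inL : Fin n → Bool) (d : Fin n → ℕ) → ℕ
numRestricted inL d = length (restrictedPairings inL d)

-- Σ_{P ∈ 𝓜(L,R,d)} I(P)   (so E(I) = totalDoubleLoops / numRestricted)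
totalDoubleLoops : {n : ℕ} (inL : Fin n → Bool) (d : Fin n → ℕ) → ℕ
totalDoubleLoops inL d = sum (map (doubleLoops d) (restrictedPairings inL d))

module Submission where

-- We prove Σ_P I(P) · M ≤ d_max³ · |𝓜(L,R,d)| as soon
-- as M ≥ 20 (so C = 1).
--
-- The proof is a switching argument.  For a pairing P, a switchable
-- configuration (p₁ , p₃ , a , c) consists of points p₁, p₃ in two different
-- loops {p₁,p₂}, {p₃,p₄} at one vertex v and points a, c away from them.
-- Counting loop points vertex by vertex, P has at least 8·I(P)·(M−4)(M−6)
-- ≥ 4·I(P)·M² switchable configurations.  Switching replaces the pairs
-- {p₁,p₂}, {p₃,p₄}, {a,b}, {c,e} by {p₁,a}, {p₂,b}, {p₃,c}, {p₄,e}.  The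
-- result is again restricted (v ∉ L because it carries a loop), and the
-- configuration is recovered from the new pairing and p₁, p₂, p₃, p₄; these
-- four points lie at one vertex, which leaves at most M·d_max³ choices.
-- Hence 4·M²·Σ_P I(P) ≤ |𝓜|·M·d_max³.

open import Defs
open import Data.Bool using (Bool; not)
open import Data.Nat using (ℕ; _+_; _*_; _^_; _≤_; _≥_)
open import Data.Nat.Divisibility using (_∣_)
open import Data.Fin using (Fin)
open import Data.Product using (∃-syntax; _×_; _,_)

module FiniteSums where

  open import Data.Bool using (true; false; _∧_; if_then_else_; T?)
  open import Data.Nat using (zero; suc; _⊔_; z≤n)
  open import Data.Nat.Properties
    using (+-identityʳ; +-mono-≤; *-zeroʳ; *-identityʳ; *-comm; *-distribˡ-+; ≤-trans; m≤m⊔n; m≤n⊔m; +-commutativeSemigroup)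
  open import Data.Nat.ListAction using (sum)
  open import Data.Nat.ListAction.Properties using (sum-++)
  open import Data.List using (List; []; _∷_; map; concatMap; _++_; length; tabulate; allFin; filter; replicate; lookup; foldr)
  open import Data.List.Properties using (map-++; map-∘; map-tabulate)
  open import Data.Fin using (_≟_) renaming (zero to fzero; suc to fsuc)
  open import Function using (_∘_; id)
  open import Algebra.Properties.CommutativeSemigroup +-commutativeSemigroup using (interchange)
  open import Relation.Binary.PropositionalEquality hiding ([_])
  open import Relation.Nullary.Decidable using (⌊_⌋)

  [_] : Bool → ℕ
  [ b ] = if b then 1 else 0

  [∧] : ∀ a b → [ a ∧ b ] ≡ [ a ] * [ b ]
  [∧] true b = sym (+-identityʳ [ b ])
  [∧] false b = refl

  ΣL : {A : Set} → List A → (A → ℕ) → ℕ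
  ΣL xs f = sum (map f xs)

  module _ {A : Set} where

    ΣL-cong : (xs : List A) {f g : A → ℕ} → (∀ x → f x ≡ g x) → ΣL xs f ≡ ΣL xs g
    ΣL-cong [] e = refl
    ΣL-cong (x ∷ xs) e = cong₂ _+_ (e x) (ΣL-cong xs e)

    ΣL-mono : (xs : List A) {f g : A → ℕ} → (∀ x → f x ≤ g x) → ΣL xs f ≤ ΣL xs g
    ΣL-mono [] e = z≤n
    ΣL-mono (x ∷ xs) e = +-mono-≤ (e x) (ΣL-mono xs e)

    ΣL-+ : (xs : List A) (f g : A → ℕ) → ΣL xs (λ x → f x + g x) ≡ ΣL xs f + ΣL xs g
    ΣL-+ [] f g = refl
    ΣL-+ (x ∷ xs) f g =
      trans (cong (f x + g x +_) (ΣL-+ xs f g)) (interchange (f x) (g x) (ΣL xs f) (ΣL xs g))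

    ΣL-*ˡ : (xs : List A) (k : ℕ) (f : A → ℕ) → ΣL xs (λ x → k * f x) ≡ k * ΣL xs f
    ΣL-*ˡ [] k f = sym (*-zeroʳ k)
    ΣL-*ˡ (x ∷ xs) k f =
      trans (cong (k * f x +_) (ΣL-*ˡ xs k f)) (sym (*-distribˡ-+ k (f x) (ΣL xs f)))

    ΣL-*ʳ : (xs : List A) (k : ℕ) (f : A → ℕ) → ΣL xs (λ x → f x * k) ≡ ΣL xs f * k
    ΣL-*ʳ xs k f = trans (ΣL-cong xs (λ x → *-comm (f x) k))
                        (trans (ΣL-*ˡ xs k f) (*-comm k (ΣL xs f)))

    ΣL-const : (xs : List A) (k : ℕ) → ΣL xs (λ _ → k) ≡ length xs * k
    ΣL-const [] k = refl
    ΣL-const (x ∷ xs) k = cong (k +_) (ΣL-const xs k)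

    ΣL-++ : (xs ys : List A) (f : A → ℕ) → ΣL (xs ++ ys) f ≡ ΣL xs f + ΣL ys f
    ΣL-++ xs ys f = trans (cong sum (map-++ f xs ys)) (sum-++ (map f xs) (map f ys))

    ΣL-tabulate : ∀ {n} (g : Fin n → A) (f : A → ℕ) → ΣL (tabulate g) f ≡ ΣL (allFin n) (f ∘ g)
    ΣL-tabulate g f = trans (cong sum (map-tabulate g f)) (sym (cong sum (map-tabulate id (f ∘ g))))

  module _ {A B : Set} where

    ΣL-swap : (xs : List A) (ys : List B) (f : A → B → ℕ) →
      ΣL xs (λ x → ΣL ys (f x)) ≡ ΣL ys (λ y → ΣL xs (λ x → f x y))
    ΣL-swap [] ys f = sym (trans (ΣL-const ys 0) (*-zeroʳ (length ys)))
    ΣL-swap (x ∷ xs) ys f =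
      trans (cong (ΣL ys (f x) +_) (ΣL-swap xs ys f)) (sym (ΣL-+ ys (f x) (λ y → ΣL xs (λ x → f x y))))

    ΣL-product : (xs : List A) (ys : List B) (f : A → ℕ) (g : B → ℕ) →
      ΣL xs (λ x → ΣL ys (λ y → f x * g y)) ≡ ΣL xs f * ΣL ys g
    ΣL-product xs ys f g = trans (ΣL-cong xs (λ x → ΣL-*ˡ ys (f x) g)) (ΣL-*ʳ xs (ΣL ys g) f)

    ΣL-map : (g : B → A) (xs : List B) (f : A → ℕ) → ΣL (map g xs) f ≡ ΣL xs (f ∘ g)
    ΣL-map g xs f = cong sum (sym (map-∘ xs))

    ΣL-concatMap : (g : B → List A) (xs : List B) (f : A → ℕ) →
      ΣL (concatMap g xs) f ≡ ΣL xs (λ x → ΣL (g x) f)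
    ΣL-concatMap g [] f = refl
    ΣL-concatMap g (x ∷ xs) f =
      trans (ΣL-++ (g x) (concatMap g xs) f) (cong (ΣL (g x) f +_) (ΣL-concatMap g xs f))

  ΣL-cube : {A : Set} (xs : List A) (B : A → Bool) →
    ΣL xs (λ x → ΣL xs (λ y → ΣL xs (λ z → [ B x ∧ (B y ∧ B z) ]))) ≡
    ΣL xs (λ x → [ B x ]) * (ΣL xs (λ x → [ B x ]) * ΣL xs (λ x → [ B x ]))
  ΣL-cube xs B = begin
    ΣL xs (λ x → ΣL xs (λ y → ΣL xs (λ z → [ B x ∧ (B y ∧ B z) ])))
      ≡⟨ ΣL-cong xs (λ x → ΣL-cong xs (λ y → ΣL-cong xs (λ z → trans ([∧] (B x) _) (cong ([ B x ] *_) ([∧] (B y) _))))) ⟩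
    ΣL xs (λ x → ΣL xs (λ y → ΣL xs (λ z → [ B x ] * ([ B y ] * [ B z ]))))
      ≡⟨ ΣL-cong xs (λ x → ΣL-cong xs (λ y → trans (ΣL-*ˡ xs [ B x ] _) (cong ([ B x ] *_) (ΣL-*ˡ xs [ B y ] _)))) ⟩
    ΣL xs (λ x → ΣL xs (λ y → [ B x ] * ([ B y ] * K)))
      ≡⟨ ΣL-product xs xs (λ x → [ B x ]) (λ y → [ B y ] * K) ⟩
    K * ΣL xs (λ y → [ B y ] * K)
      ≡⟨ cong (K *_) (ΣL-*ʳ xs K _) ⟩
    K * (K * K) ∎
    where
    open ≡-Reasoning
    K : ℕ
    K = ΣL xs (λ x → [ B x ])

  ΣL-filter : {A B : Set} (xs : List B) (h : B → A) (p : A → Bool) (g : A → ℕ) →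
    ΣL (filter (λ y → T? (p y)) (map h xs)) g ≡ ΣL xs (λ x → [ p (h x) ] * g (h x))
  ΣL-filter [] h p g = refl
  ΣL-filter (x ∷ xs) h p g with p (h x)
  ... | true = cong₂ _+_ (sym (+-identityʳ (g (h x)))) (ΣL-filter xs h p g)
  ... | false = ΣL-filter xs h p g

  positions-of : ∀ {n} (xs : List (Fin n)) v →
    ΣL (allFin (length xs)) (λ q → [ ⌊ lookup xs q ≟ v ⌋ ]) ≡ ΣL xs (λ u → [ ⌊ u ≟ v ⌋ ])
  positions-of [] v = refl
  positions-of (x ∷ xs) v = cong ([ ⌊ x ≟ v ⌋ ] +_)
    (trans (ΣL-tabulate {n = length xs} fsuc (λ q → [ ⌊ lookup (x ∷ xs) q ≟ v ⌋ ])) (positions-of xs v))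

  ΣL-replicate : {A : Set} (k : ℕ) (u : A) (g : A → ℕ) → ΣL (replicate k u) g ≡ k * g u
  ΣL-replicate zero u g = refl
  ΣL-replicate (suc k) u g = cong (g u +_) (ΣL-replicate k u g)

  ≤-max : {A : Set} (k : ℕ) (h : Fin k → A) (g : A → ℕ) (i : Fin k) → g (h i) ≤ foldr _⊔_ 0 (map g (tabulate h))
  ≤-max (suc k) h g fzero = m≤m⊔n _ _
  ≤-max (suc k) h g (fsuc i) = ≤-trans (≤-max k (λ j → h (fsuc j)) g i) (m≤n⊔m (g (h fzero)) _)

  length≡ΣL : {A : Set} (xs : List A) → length xs ≡ ΣL xs (λ _ → 1)
  length≡ΣL xs = sym (trans (ΣL-const xs 1) (*-identityʳ (length xs)))

module Enumerations where

  open FiniteSums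
  open import Data.Bool using (true; false)
  open import Data.Nat using (zero; suc; z≤n)
  open import Data.Nat.Properties using (*-identityˡ; *-identityʳ; *-zeroʳ; ≤-refl; module ≤-Reasoning)
  open import Data.List using (List; map; concatMap; allFin; length)
  open import Data.Fin using (_≟_) renaming (zero to fzero; suc to fsuc)
  open import Data.Fin.Properties using (suc-injective)
  open import Data.Vec using (Vec; []; _∷_)
  open import Data.Vec.Properties using (∷-injective) renaming (≡-dec to Vec-≡-dec)
  open import Data.Product using (proj₁; proj₂; ∃₂)
  open import Data.Product.Properties using (,-injective) renaming (≡-dec to ×-≡-dec)
  open import Relation.Binary.PropositionalEquality hiding ([_])
  open import Relation.Binary.Definitions using (DecidableEquality)
  open import Relation.Nullary using (Dec; yes; no; ¬_)
  open import Relation.Nullary.Decidable using (⌊_⌋)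
  open import Data.Empty using (⊥-elim)
  open import Function using (_∘_)

  module _ {P : Set} where

    [yes] : (p? : Dec P) → P → [ ⌊ p? ⌋ ] ≡ 1
    [yes] (yes _) p = refl
    [yes] (no ¬p) p = ⊥-elim (¬p p)

    [no] : (p? : Dec P) → ¬ P → [ ⌊ p? ⌋ ] ≡ 0
    [no] (yes p) ¬p = ⊥-elim (¬p p)
    [no] (no _) ¬p = refl

  record Enum (A : Set) : Set where
    field
      elems : List A
      deq : DecidableEquality A
      once : ∀ c → ΣL elems (λ a → [ ⌊ deq a c ⌋ ]) ≡ 1
  open Enum public

  module _ {A : Set} (E : Enum A) where

    ΣE : (A → ℕ) → ℕ
    ΣE = ΣL (elems E)

    pick : (c : A) (g : A → ℕ) → ΣE (λ a → [ ⌊ deq E a c ⌋ ] * g a) ≡ g c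
    pick c g = begin
      ΣE (λ a → [ ⌊ deq E a c ⌋ ] * g a) ≡⟨ ΣL-cong (elems E) at-centre ⟩
      ΣE (λ a → [ ⌊ deq E a c ⌋ ] * g c) ≡⟨ ΣL-*ʳ (elems E) (g c) _ ⟩
      ΣE (λ a → [ ⌊ deq E a c ⌋ ]) * g c ≡⟨ cong (_* g c) (once E c) ⟩
      1 * g c                           ≡⟨ *-identityˡ (g c) ⟩
      g c ∎
      where
      open ≡-Reasoning
      at-centre : ∀ a → [ ⌊ deq E a c ⌋ ] * g a ≡ [ ⌊ deq E a c ⌋ ] * g c
      at-centre a with deq E a c
      ... | yes refl = refl
      ... | no _ = refl

  count-by-injection : {A B : Set} (EA : Enum A) (EB : Enum B) (PA : A → Bool) (PB : B → Bool)
    (f : A → B) (h : B → A) →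
    (∀ x → PA x ≡ true → (PB (f x) ≡ true) × (h (f x) ≡ x)) →
    ΣE EA (λ x → [ PA x ]) ≤ ΣE EB (λ y → [ PB y ])
  count-by-injection EA EB PA PB f h inj = begin
    ΣE EA (λ x → [ PA x ])
      ≡⟨ ΣL-cong (elems EA) (λ x → sym (trans (cong ([ PA x ] *_) (once EB (f x))) (*-identityʳ _))) ⟩
    ΣE EA (λ x → [ PA x ] * ΣE EB (λ y → [ ⌊ deq EB y (f x) ⌋ ]))
      ≡⟨ ΣL-cong (elems EA) (λ x → sym (ΣL-*ˡ (elems EB) [ PA x ] _)) ⟩
    ΣE EA (λ x → ΣE EB (λ y → [ PA x ] * [ ⌊ deq EB y (f x) ⌋ ]))
      ≡⟨ ΣL-swap (elems EA) (elems EB) _ ⟩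
    ΣE EB (λ y → ΣE EA (λ x → [ PA x ] * [ ⌊ deq EB y (f x) ⌋ ]))
      ≤⟨ ΣL-mono (elems EB) (λ y → ΣL-mono (elems EA) (λ x → graph≤cograph x y)) ⟩
    ΣE EB (λ y → ΣE EA (λ x → [ PB y ] * [ ⌊ deq EA x (h y) ⌋ ]))
      ≡⟨ ΣL-cong (elems EB) (λ y → ΣL-*ˡ (elems EA) [ PB y ] _) ⟩
    ΣE EB (λ y → [ PB y ] * ΣE EA (λ x → [ ⌊ deq EA x (h y) ⌋ ]))
      ≡⟨ ΣL-cong (elems EB) (λ y → trans (cong ([ PB y ] *_) (once EA (h y))) (*-identityʳ _)) ⟩
    ΣE EB (λ y → [ PB y ]) ∎
    where
    open ≤-Reasoning
    -- the graph of f on PA lies inside the (transposed) graph of h on PB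
    graph≤cograph : ∀ x y → [ PA x ] * [ ⌊ deq EB y (f x) ⌋ ] ≤ [ PB y ] * [ ⌊ deq EA x (h y) ⌋ ]
    graph≤cograph x y with PA x in PAx
    ... | false = z≤n
    ... | true with deq EB y (f x)
    ...   | no _ = z≤n
    ...   | yes refl with inj x PAx
    ...     | PBfx , hfx≡x rewrite PBfx | [yes] (deq EA x (h (f x))) (sym hfx≡x) = ≤-refl

  allFin-once : ∀ n (c : Fin n) → ΣL (allFin n) (λ a → [ ⌊ a ≟ c ⌋ ]) ≡ 1
  allFin-once (suc n) fzero =
    cong suc (trans (ΣL-tabulate {n = n} fsuc (λ a → [ ⌊ a ≟ fzero ⌋ ]))
      (trans (ΣL-cong (allFin n) {λ a → [ ⌊ fsuc a ≟ fzero ⌋ ]} (λ a → [no] (fsuc a ≟ fzero) (λ ())))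
        (trans (ΣL-const (allFin n) 0) (*-zeroʳ (length (allFin n))))))
  allFin-once (suc n) (fsuc c) =
    trans (ΣL-tabulate {n = n} fsuc (λ a → [ ⌊ a ≟ fsuc c ⌋ ]))
      (trans (ΣL-cong (allFin n) shift) (allFin-once n c))
    where
    shift : ∀ a → [ ⌊ fsuc a ≟ fsuc c ⌋ ] ≡ [ ⌊ a ≟ c ⌋ ]
    shift a = by-cases (a ≟ c)
      where
      by-cases : Dec (a ≡ c) → [ ⌊ fsuc a ≟ fsuc c ⌋ ] ≡ [ ⌊ a ≟ c ⌋ ]
      by-cases (yes a≡c) = trans ([yes] (fsuc a ≟ fsuc c) (cong fsuc a≡c)) (sym ([yes] (a ≟ c) a≡c))
      by-cases (no a≢c) = trans ([no] (fsuc a ≟ fsuc c) (a≢c ∘ suc-injective)) (sym ([no] (a ≟ c) a≢c))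

  finEnum : ∀ n → Enum (Fin n)
  finEnum n = record { elems = allFin n ; deq = _≟_ ; once = allFin-once n }

  module Pairing {A B C : Set} (EA : Enum A) (EB : Enum B) (_≟C_ : DecidableEquality C)
    (g : A → B → C) (g-injective : ∀ {a a′ b b′} → g a b ≡ g a′ b′ → a ≡ a′ × b ≡ b′)
    (g-surjective : ∀ c → ∃₂ λ a b → g a b ≡ c) where

    pairedList : List C
    pairedList = concatMap (λ a → map (g a) (elems EB)) (elems EA)

    Σ-paired : (f : C → ℕ) → ΣL pairedList f ≡ ΣE EA (λ a → ΣE EB (λ b → f (g a b)))
    Σ-paired f = trans (ΣL-concatMap _ (elems EA) f)
                       (ΣL-cong (elems EA) (λ a → ΣL-map (g a) (elems EB) f))

    delta-split : ∀ a b a₀ b₀ → [ ⌊ g a b ≟C g a₀ b₀ ⌋ ] ≡ [ ⌊ deq EA a a₀ ⌋ ] * [ ⌊ deq EB b b₀ ⌋ ]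
    delta-split a b a₀ b₀ with deq EA a a₀ | deq EB b b₀
    ... | yes refl | yes refl = [yes] (g a b ≟C g a b) refl
    ... | yes refl | no b≢b₀ = [no] (g a b ≟C g a b₀) (b≢b₀ ∘ proj₂ ∘ g-injective)
    ... | no a≢a₀ | _ = [no] (g a b ≟C g a₀ b₀) (a≢a₀ ∘ proj₁ ∘ g-injective)

    pairedOnce : ∀ c → ΣL pairedList (λ x → [ ⌊ x ≟C c ⌋ ]) ≡ 1
    pairedOnce c with g-surjective c
    ... | a₀ , b₀ , refl = begin
      ΣL pairedList (λ x → [ ⌊ x ≟C g a₀ b₀ ⌋ ])
        ≡⟨ Σ-paired _ ⟩
      ΣE EA (λ a → ΣE EB (λ b → [ ⌊ g a b ≟C g a₀ b₀ ⌋ ]))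
        ≡⟨ ΣL-cong (elems EA) (λ a → ΣL-cong (elems EB) (λ b → delta-split a b a₀ b₀)) ⟩
      ΣE EA (λ a → ΣE EB (λ b → [ ⌊ deq EA a a₀ ⌋ ] * [ ⌊ deq EB b b₀ ⌋ ]))
        ≡⟨ ΣL-cong (elems EA) (λ a → ΣL-*ˡ (elems EB) [ ⌊ deq EA a a₀ ⌋ ] (λ b → [ ⌊ deq EB b b₀ ⌋ ])) ⟩
      ΣE EA (λ a → [ ⌊ deq EA a a₀ ⌋ ] * ΣE EB (λ b → [ ⌊ deq EB b b₀ ⌋ ]))
        ≡⟨ pick EA a₀ (λ _ → ΣE EB (λ b → [ ⌊ deq EB b b₀ ⌋ ])) ⟩
      ΣE EB (λ b → [ ⌊ deq EB b b₀ ⌋ ])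
        ≡⟨ once EB b₀ ⟩
      1 ∎
      where open ≡-Reasoning

    pairedEnum : Enum C
    pairedEnum = record { elems = pairedList ; deq = _≟C_ ; once = pairedOnce }

  module Product {A B : Set} (EA : Enum A) (EB : Enum B) =
    Pairing EA EB (×-≡-dec (deq EA) (deq EB)) _,_ ,-injective (λ c → proj₁ c , proj₂ c , refl)

  _×ₑ_ : {A B : Set} → Enum A → Enum B → Enum (A × B)
  EA ×ₑ EB = Product.pairedEnum EA EB

  Σ× : {A B : Set} (EA : Enum A) (EB : Enum B) (f : A × B → ℕ) →
    ΣE (EA ×ₑ EB) f ≡ ΣE EA (λ a → ΣE EB (λ b → f (a , b)))
  Σ× = Product.Σ-paired

  vecEnum : ∀ m k → Enum (Vec (Fin m) k)
  vecEnum m zero = record { elems = allVecs m zero ; deq = Vec-≡-dec _≟_ ; once = λ { [] → refl } }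
  vecEnum m (suc k) = Pairing.pairedEnum (finEnum m) (vecEnum m k) (Vec-≡-dec _≟_) _∷_ ∷-injective
                        (λ { (x ∷ xs) → x , xs , refl })

  vecEnum-elems : ∀ m k → elems (vecEnum m k) ≡ allVecs m k
  vecEnum-elems m zero = refl
  vecEnum-elems m (suc k) = cong (λ vs → concatMap (λ x → map (x ∷_) vs) (allFin m)) (vecEnum-elems m k)

module Reflection where

  open import Data.Bool using (true; _∧_)
  open import Data.Bool.ListAction using (and)
  open import Data.Nat using (zero; suc)
  open import Data.List using (map; tabulate)
  open import Data.Fin using (Fin) renaming (zero to fzero; suc to fsuc)
  open import Data.Product using (proj₁; proj₂)
  open import Relation.Binary.PropositionalEquality
  open import Relation.Nullary using (Dec; yes; no; ¬_)
  open import Relation.Nullary.Decidable using (⌊_⌋)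
  open import Data.Empty using (⊥-elim)
  open import Function using (_∘_)

  ∧-split : ∀ {a b} → a ∧ b ≡ true → a ≡ true × b ≡ true
  ∧-split {true} b≡true = refl , b≡true

  ∧-join : ∀ {a b} → a ≡ true → b ≡ true → a ∧ b ≡ true
  ∧-join refl b≡true = b≡true

  module _ {P : Set} where

    yes-sound : (p? : Dec P) → ⌊ p? ⌋ ≡ true → P
    yes-sound (yes p) _ = p

    no-sound : (p? : Dec P) → not ⌊ p? ⌋ ≡ true → ¬ P
    no-sound (no ¬p) _ = ¬p

    yes-complete : (p? : Dec P) → P → ⌊ p? ⌋ ≡ true
    yes-complete (yes _) p = refl
    yes-complete (no ¬p) p = ⊥-elim (¬p p)

    no-complete : (p? : Dec P) → ¬ P → not ⌊ p? ⌋ ≡ true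
    no-complete (yes p) ¬p = ⊥-elim (¬p p)
    no-complete (no _) ¬p = refl

  module _ {A : Set} where

    and-sound : ∀ k (h : Fin k → A) (g : A → Bool) →
      and (map g (tabulate h)) ≡ true → ∀ i → g (h i) ≡ true
    and-sound (suc k) h g all-true fzero = proj₁ (∧-split all-true)
    and-sound (suc k) h g all-true (fsuc i) = and-sound k (h ∘ fsuc) g (proj₂ (∧-split all-true)) i

    and-complete : ∀ k (h : Fin k → A) (g : A → Bool) →
      (∀ i → g (h i) ≡ true) → and (map g (tabulate h)) ≡ true
    and-complete zero h g each = refl
    and-complete (suc k) h g each = ∧-join (each fzero) (and-complete k (h ∘ fsuc) g (each ∘ fsuc))

module Avoiding {m : ℕ} where

  open FiniteSums
  open Enumerations using (allFin-once)
  open Reflection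
  open import Data.Bool using (true; false; _∧_)
  open import Data.Bool.Properties using (∧-identityʳ)
  open import Data.Nat using (_∸_; z≤n; s≤s)
  open import Data.Nat.Properties
    using (≤-trans; ≤-reflexive; m≤m+n; +-monoˡ-≤; +-assoc; ∸-monoˡ-≤; m+n∸n≡m; module ≤-Reasoning)
  open import Data.List using (List; []; _∷_; length; allFin)
  open import Data.List.Properties using (length-tabulate)
  open import Data.List.Relation.Unary.All using (All; []; _∷_)
  open import Data.Fin using (_≟_)
  open import Data.Product using (proj₁; proj₂)
  open import Function using (id)
  open import Relation.Binary.PropositionalEquality hiding ([_])
  open import Relation.Nullary.Decidable using (⌊_⌋)

  ΣP : (Fin m → ℕ) → ℕ
  ΣP = ΣL (allFin m)

  ΣP-1 : ΣP (λ _ → 1) ≡ m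
  ΣP-1 = trans (sym (length≡ΣL (allFin m))) (length-tabulate id)

  notIn : List (Fin m) → Fin m → Bool
  notIn [] x = true
  notIn (e ∷ es) x = not ⌊ x ≟ e ⌋ ∧ notIn es x

  notIn-sound : ∀ es {x} → notIn es x ≡ true → All (x ≢_) es
  notIn-sound [] _ = []
  notIn-sound (e ∷ es) {x} h = no-sound (x ≟ e) (proj₁ (∧-split h)) ∷ notIn-sound es (proj₂ (∧-split h))

  exclude : (B : Fin m → Bool) (es : List (Fin m)) →
    ΣP (λ x → [ B x ]) ≤ ΣP (λ x → [ B x ∧ notIn es x ]) + length es
  exclude B [] = ≤-trans (≤-reflexive (ΣL-cong (allFin m) (λ x → cong [_] (sym (∧-identityʳ (B x)))))) (m≤m+n _ 0)
  exclude B (e ∷ es) = begin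
    ΣP (λ x → [ B x ])                                        ≤⟨ exclude B es ⟩
    ΣP (λ x → [ B x ∧ notIn es x ]) + length es
      ≤⟨ +-monoˡ-≤ (length es) (ΣL-mono (allFin m) (λ x → split (B x) ⌊ x ≟ e ⌋ (notIn es x))) ⟩
    ΣP (λ x → [ B x ∧ notIn (e ∷ es) x ] + [ ⌊ x ≟ e ⌋ ]) + length es
      ≡⟨ cong (_+ length es) (trans (ΣL-+ (allFin m) _ _) (cong (ΣP (λ x → [ B x ∧ notIn (e ∷ es) x ]) +_) (allFin-once m e))) ⟩
    ΣP (λ x → [ B x ∧ notIn (e ∷ es) x ]) + 1 + length es     ≡⟨ +-assoc _ 1 (length es) ⟩
    ΣP (λ x → [ B x ∧ notIn (e ∷ es) x ]) + length (e ∷ es)   ∎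
    where
    open ≤-Reasoning
    -- a point of B either differs from e or is e
    split : ∀ b c r → [ b ∧ r ] ≤ [ b ∧ (not c ∧ r) ] + [ c ]
    split true true true = s≤s z≤n
    split true true false = z≤n
    split true false r = m≤m+n [ r ] 0
    split false c r = z≤n

  exclude-≥ : (B : Fin m → Bool) (es : List (Fin m)) →
    ΣP (λ x → [ B x ]) ∸ length es ≤ ΣP (λ x → [ B x ∧ notIn es x ])
  exclude-≥ B es = ≤-trans (∸-monoˡ-≤ (length es) (exclude B es)) (≤-reflexive (m+n∸n≡m _ (length es)))

  avoiding-≥ : (es : List (Fin m)) → m ∸ length es ≤ ΣP (λ x → [ notIn es x ])
  avoiding-≥ es = subst (λ k → k ∸ length es ≤ ΣP (λ x → [ notIn es x ])) ΣP-1 (exclude-≥ (λ _ → true) es)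

module Transpositions where

  open import Data.Fin using (_≟_)
  open import Data.Fin.Permutation.Components using (transpose) public
  open import Relation.Binary.PropositionalEquality
  open import Relation.Nullary using (Dec; yes; no)
  open import Relation.Nullary.Decidable using (dec-true; dec-false)

  module _ {m : ℕ} where

    transpose-at-i : (i j : Fin m) → transpose i j i ≡ j
    transpose-at-i i j rewrite dec-true (i ≟ i) refl = refl

    transpose-at-j : (i j : Fin m) → transpose i j j ≡ i
    transpose-at-j i j = by-cases (j ≟ i)
      where
      by-cases : Dec (j ≡ i) → transpose i j j ≡ i
      by-cases (yes j≡i) rewrite j≡i = transpose-at-i i i
      by-cases (no j≢i) rewrite dec-false (j ≟ i) j≢i | dec-true (j ≟ j) refl = refl

    transpose-fixes : {i j k : Fin m} → k ≢ i → k ≢ j → transpose i j k ≡ k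
    transpose-fixes {i} {j} {k} k≢i k≢j rewrite dec-false (k ≟ i) k≢i | dec-false (k ≟ j) k≢j = refl

    transpose-involutive : (i j k : Fin m) → transpose i j (transpose i j k) ≡ k
    transpose-involutive i j k = by-cases (k ≟ i) (k ≟ j)
      where
      by-cases : Dec (k ≡ i) → Dec (k ≡ j) → transpose i j (transpose i j k) ≡ k
      by-cases (yes k≡i) _ rewrite k≡i =
        trans (cong (transpose i j) (transpose-at-i i j)) (transpose-at-j i j)
      by-cases (no _) (yes k≡j) rewrite k≡j =
        trans (cong (transpose i j) (transpose-at-j i j)) (transpose-at-i i j)
      by-cases (no k≢i) (no k≢j) =
        trans (cong (transpose i j) (transpose-fixes k≢i k≢j)) (transpose-fixes k≢i k≢j)

-- Writing p₂ = f p₁,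
-- p₄ = f p₃, b = f a, e = f c, it replaces the pairs {p₁,p₂}, {p₃,p₄},
-- {a,b}, {c,e} of f by {p₁,a}, {p₂,b}, {p₃,c}, {p₄,e}; it is conjugation of
-- f by the transpositions (p₂ a) and (p₄ c).
module Switching {m : ℕ} where

  open Transpositions
  open import Data.Fin using (_≟_)
  open import Data.Sum using (_⊎_; inj₁; inj₂)
  open import Function using (_∘_)
  open import Relation.Binary.PropositionalEquality
  open import Relation.Nullary using (Dec; yes; no)

  record IsPairing (f : Fin m → Fin m) : Set where
    field
      no-fixed-point : ∀ x → f x ≢ x
      involutive : ∀ x → f (f x) ≡ x

  conjugate-pairing : {f : Fin m → Fin m} (σ τ : Fin m → Fin m) →
    (∀ x → σ (τ x) ≡ x) → (∀ x → τ (σ x) ≡ x) → IsPairing f → IsPairing (λ x → σ (f (τ x)))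
  conjugate-pairing {f} σ τ στ τσ f-pairing = record
    { no-fixed-point = λ x eq → no-fixed-point (τ x) (trans (sym (τσ (f (τ x)))) (cong τ eq))
    ; involutive = λ x → trans (cong (σ ∘ f) (τσ (f (τ x)))) (trans (cong σ (involutive (τ x))) (στ x))
    }
    where open IsPairing f-pairing

  pairing-≗ : {f g : Fin m → Fin m} → (∀ x → g x ≡ f x) → IsPairing f → IsPairing g
  pairing-≗ {f} {g} g≗f f-pairing = record
    { no-fixed-point = λ x eq → no-fixed-point x (trans (sym (g≗f x)) eq)
    ; involutive = λ x → trans (cong g (g≗f x)) (trans (g≗f (f x)) (involutive x))
    }
    where open IsPairing f-pairing

  conjugate₂ : (i j k l : Fin m) → (Fin m → Fin m) → Fin m → Fin m
  conjugate₂ i j k l g x = transpose i j (transpose k l (g (transpose k l (transpose i j x))))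

  conjugate₂-pairing : ∀ i j k l {g} → IsPairing g → IsPairing (conjugate₂ i j k l g)
  conjugate₂-pairing i j k l =
    conjugate-pairing (transpose i j ∘ transpose k l) (transpose k l ∘ transpose i j)
      (λ x → trans (cong (transpose i j) (transpose-involutive k l (transpose i j x))) (transpose-involutive i j x))
      (λ x → trans (cong (transpose k l) (transpose-involutive i j (transpose k l x))) (transpose-involutive k l x))

  conjugate₂-cong : ∀ i j k l {g h} → (∀ x → g x ≡ h x) → ∀ x → conjugate₂ i j k l g x ≡ conjugate₂ i j k l h x
  conjugate₂-cong i j k l g≗h x = cong (transpose i j ∘ transpose k l) (g≗h (transpose k l (transpose i j x)))

  conjugate₂-inverse : ∀ i j k l g x → conjugate₂ k l i j (conjugate₂ i j k l g) x ≡ g x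
  conjugate₂-inverse i j k l g x =
    trans (cong (transpose k l ∘ transpose i j ∘ transpose i j ∘ transpose k l ∘ g) (undo x)) (undo (g x))
    where
    undo : ∀ y → transpose k l (transpose i j (transpose i j (transpose k l y))) ≡ y
    undo y = trans (cong (transpose k l) (transpose-involutive i j (transpose k l y))) (transpose-involutive k l y)

  switch : (f : Fin m → Fin m) (p₁ p₃ a c : Fin m) → Fin m → Fin m
  switch f p₁ p₃ a c = conjugate₂ (f p₃) c (f p₁) a f

  record Switchable (f : Fin m → Fin m) (p₁ p₃ a c : Fin m) : Set where
    field
      p₃≢p₁ : p₃ ≢ p₁
      p₃≢p₂ : p₃ ≢ f p₁
      a≢p₁ : a ≢ p₁
      a≢p₂ : a ≢ f p₁
      a≢p₃ : a ≢ p₃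
      a≢p₄ : a ≢ f p₃
      c≢p₁ : c ≢ p₁
      c≢p₂ : c ≢ f p₁
      c≢p₃ : c ≢ p₃
      c≢p₄ : c ≢ f p₃
      c≢a : c ≢ a
      c≢b : c ≢ f a

  module Switch {f : Fin m → Fin m} (f-pairing : IsPairing f) {p₁ p₃ a c : Fin m}
    (switchable : Switchable f p₁ p₃ a c) where

    open IsPairing f-pairing
    open Switchable switchable

    p₂ p₄ b e : Fin m
    p₂ = f p₁
    p₄ = f p₃
    b = f a
    e = f c

    f′ : Fin m → Fin m
    f′ = switch f p₁ p₃ a c

    f′-pairing : IsPairing f′
    f′-pairing = conjugate₂-pairing (f p₃) c (f p₁) a f-pairing

    -- The remaining distinctness facts among the eight points follow from
    -- f being an injective fixed-point-free involution.
    private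
      f-injective : ∀ {x y} → f x ≡ f y → x ≡ y
      f-injective {x} {y} eq = trans (sym (involutive x)) (trans (cong f eq) (involutive y))

      f-≢ : ∀ {x y} → x ≢ y → f x ≢ f y
      f-≢ x≢y = x≢y ∘ f-injective

      ≢-flip : ∀ {x y} → x ≢ f y → f x ≢ y
      ≢-flip {x} x≢fy eq = x≢fy (trans (sym (involutive x)) (cong f eq))

      p₂≢p₁ : p₂ ≢ p₁
      p₂≢p₁ = no-fixed-point p₁
      p₄≢p₃ : p₄ ≢ p₃
      p₄≢p₃ = no-fixed-point p₃
      p₄≢p₂ : p₄ ≢ p₂
      p₄≢p₂ = f-≢ p₃≢p₁
      p₄≢p₁ : p₄ ≢ p₁
      p₄≢p₁ = ≢-flip p₃≢p₂
      b≢p₂ : b ≢ p₂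
      b≢p₂ = f-≢ a≢p₁
      b≢p₄ : b ≢ p₄
      b≢p₄ = f-≢ a≢p₃
      b≢a : b ≢ a
      b≢a = no-fixed-point a
      e≢p₂ : e ≢ p₂
      e≢p₂ = f-≢ c≢p₁
      e≢p₄ : e ≢ p₄
      e≢p₄ = f-≢ c≢p₃
      e≢a : e ≢ a
      e≢a = ≢-flip c≢b
      e≢c : e ≢ c
      e≢c = no-fixed-point c

      σ₁ σ₂ : Fin m → Fin m
      σ₁ = transpose p₂ a
      σ₂ = transpose p₄ c

      σ₁σ₂-fixes : ∀ {x} → x ≢ p₂ → x ≢ a → x ≢ p₄ → x ≢ c → σ₁ (σ₂ x) ≡ x
      σ₁σ₂-fixes x≢p₂ x≢a x≢p₄ x≢c =
        trans (cong σ₁ (transpose-fixes x≢p₄ x≢c)) (transpose-fixes x≢p₂ x≢a)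

      σ₂σ₁-fixes : ∀ {x} → x ≢ p₂ → x ≢ a → x ≢ p₄ → x ≢ c → σ₂ (σ₁ x) ≡ x
      σ₂σ₁-fixes x≢p₂ x≢a x≢p₄ x≢c =
        trans (cong σ₂ (transpose-fixes x≢p₂ x≢a)) (transpose-fixes x≢p₄ x≢c)

    f′-p₁ : f′ p₁ ≡ a
    f′-p₁ = trans (cong (σ₂ ∘ σ₁ ∘ f) (σ₁σ₂-fixes (≢-sym p₂≢p₁) (≢-sym a≢p₁) (≢-sym p₄≢p₁) (≢-sym c≢p₁)))
              (trans (cong σ₂ (transpose-at-i p₂ a)) (transpose-fixes a≢p₄ (≢-sym c≢a)))

    f′-p₃ : f′ p₃ ≡ c
    f′-p₃ = trans (cong (σ₂ ∘ σ₁ ∘ f) (σ₁σ₂-fixes p₃≢p₂ (≢-sym a≢p₃) (≢-sym p₄≢p₃) (≢-sym c≢p₃)))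
              (trans (cong σ₂ (transpose-fixes p₄≢p₂ (≢-sym a≢p₄))) (transpose-at-i p₄ c))

    f′-a : f′ a ≡ p₁
    f′-a = trans (cong (σ₂ ∘ σ₁ ∘ f) (trans (cong σ₁ (transpose-fixes a≢p₄ (≢-sym c≢a))) (transpose-at-j p₂ a)))
             (trans (cong (σ₂ ∘ σ₁) (involutive p₁))
               (σ₂σ₁-fixes (≢-sym p₂≢p₁) (≢-sym a≢p₁) (≢-sym p₄≢p₁) (≢-sym c≢p₁)))

    f′-b : f′ b ≡ p₂
    f′-b = trans (cong (σ₂ ∘ σ₁ ∘ f) (σ₁σ₂-fixes b≢p₂ b≢a b≢p₄ (≢-sym c≢b)))
             (trans (cong (σ₂ ∘ σ₁) (involutive a))
               (trans (cong σ₂ (transpose-at-j p₂ a)) (transpose-fixes (≢-sym p₄≢p₂) (≢-sym c≢p₂))))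

    f′-c : f′ c ≡ p₃
    f′-c = trans (cong (σ₂ ∘ σ₁ ∘ f) (trans (cong σ₁ (transpose-at-j p₄ c)) (transpose-fixes p₄≢p₂ (≢-sym a≢p₄))))
             (trans (cong (σ₂ ∘ σ₁) (involutive p₃))
               (σ₂σ₁-fixes p₃≢p₂ (≢-sym a≢p₃) (≢-sym p₄≢p₃) (≢-sym c≢p₃)))

    f′-e : f′ e ≡ p₄
    f′-e = trans (cong (σ₂ ∘ σ₁ ∘ f) (σ₁σ₂-fixes e≢p₂ e≢a e≢p₄ e≢c))
             (trans (cong (σ₂ ∘ σ₁) (involutive c))
               (trans (cong σ₂ (transpose-fixes c≢p₂ c≢a)) (transpose-at-j p₄ c)))

    f′-elsewhere : ∀ {x} → x ≢ p₁ → x ≢ p₂ → x ≢ p₃ → x ≢ p₄ →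
      x ≢ a → x ≢ b → x ≢ c → x ≢ e → f′ x ≡ f x
    f′-elsewhere x≢p₁ x≢p₂ x≢p₃ x≢p₄ x≢a x≢b x≢c x≢e =
      trans (cong (σ₂ ∘ σ₁ ∘ f) (σ₁σ₂-fixes x≢p₂ x≢a x≢p₄ x≢c))
        (σ₂σ₁-fixes (x≢p₁ ∘ f-injective) (≢-flip x≢b) (x≢p₃ ∘ f-injective) (≢-flip x≢e))

    new-pairs-touch : (G : Fin m → Set) → G p₁ → G p₂ → G p₃ → G p₄ →
      ∀ x → G x ⊎ G (f′ x) ⊎ f′ x ≡ f x
    new-pairs-touch G g₁ g₂ g₃ g₄ x =
      by-cases (x ≟ p₁) (x ≟ p₂) (x ≟ p₃) (x ≟ p₄) (x ≟ a) (x ≟ b) (x ≟ c) (x ≟ e)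
      where
      by-cases : Dec (x ≡ p₁) → Dec (x ≡ p₂) → Dec (x ≡ p₃) → Dec (x ≡ p₄) →
        Dec (x ≡ a) → Dec (x ≡ b) → Dec (x ≡ c) → Dec (x ≡ e) → G x ⊎ G (f′ x) ⊎ f′ x ≡ f x
      by-cases (yes refl) _ _ _ _ _ _ _ = inj₁ g₁
      by-cases _ (yes refl) _ _ _ _ _ _ = inj₁ g₂
      by-cases _ _ (yes refl) _ _ _ _ _ = inj₁ g₃
      by-cases _ _ _ (yes refl) _ _ _ _ = inj₁ g₄
      by-cases _ _ _ _ (yes refl) _ _ _ = inj₂ (inj₁ (subst G (sym f′-a) g₁))
      by-cases _ _ _ _ _ (yes refl) _ _ = inj₂ (inj₁ (subst G (sym f′-b) g₂))
      by-cases _ _ _ _ _ _ (yes refl) _ = inj₂ (inj₁ (subst G (sym f′-c) g₃))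
      by-cases _ _ _ _ _ _ _ (yes refl) = inj₂ (inj₁ (subst G (sym f′-e) g₄))
      by-cases (no x≢p₁) (no x≢p₂) (no x≢p₃) (no x≢p₄) (no x≢a) (no x≢b) (no x≢c) (no x≢e) =
        inj₂ (inj₂ (f′-elsewhere x≢p₁ x≢p₂ x≢p₃ x≢p₄ x≢a x≢b x≢c x≢e))

    unswitch : ∀ x → conjugate₂ p₂ a p₄ c f′ x ≡ f x
    unswitch = conjugate₂-inverse p₄ c p₂ a f

module Estimates where

  open import Data.Nat
  open import Data.Nat.Properties
  open import Data.Nat.Combinatorics using (_C_; nC1≡n; nCk+nC[k+1]≡[n+1]C[k+1])
  open import Data.Nat.DivMod using (m/n*n≤m)
  open import Data.Nat.Tactic.RingSolver using (solve-∀)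
  open import Relation.Binary.PropositionalEquality

  C2-suc : ∀ k → suc k C 2 ≡ k + k C 2
  C2-suc k = trans (sym (nCk+nC[k+1]≡[n+1]C[k+1] k 1)) (cong (_+ k C 2) (nC1≡n k))

  eight-C2 : ∀ k → 8 * (k C 2) ≡ (k * 2) * (k * 2 ∸ 2)
  eight-C2 zero = refl
  eight-C2 (suc zero) = refl
  eight-C2 (suc (suc j)) = begin
    8 * (suc (suc j) C 2)               ≡⟨ cong (8 *_) (C2-suc (suc j)) ⟩
    8 * (suc j + suc j C 2)             ≡⟨ *-distribˡ-+ 8 (suc j) (suc j C 2) ⟩
    8 * suc j + 8 * (suc j C 2)         ≡⟨ cong (8 * suc j +_) (eight-C2 (suc j)) ⟩
    8 * suc j + (suc j * 2) * (j * 2)   ≡⟨ expand j ⟩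
    (suc (suc j) * 2) * (suc j * 2)     ∎
    where
    open ≡-Reasoning
    expand : ∀ j → 8 * suc j + (suc j * 2) * (j * 2) ≡ (suc (suc j) * 2) * (suc j * 2)
    expand = solve-∀

  eight-C2-half : ∀ c → 8 * ((c / 2) C 2) ≤ c * (c ∸ 2)
  eight-C2-half c = begin
    8 * ((c / 2) C 2)                    ≡⟨ eight-C2 (c / 2) ⟩
    (c / 2 * 2) * (c / 2 * 2 ∸ 2)        ≤⟨ *-mono-≤ half≤ (∸-monoˡ-≤ 2 half≤) ⟩
    c * (c ∸ 2)                          ∎
    where
    open ≤-Reasoning
    half≤ : c / 2 * 2 ≤ c
    half≤ = m/n*n≤m c 2

  square≤twice-shifted : ∀ m → 20 ≤ m → m * m ≤ 2 * ((m ∸ 4) * (m ∸ 6))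
  square≤twice-shifted m 20≤m =
    subst (λ z → z * z ≤ 2 * ((z ∸ 4) * (z ∸ 6))) (m+[n∸m]≡n 6≤m) (shifted (m ∸ 6) (∸-monoˡ-≤ 6 20≤m))
    where
    6≤m : 6 ≤ m
    6≤m = ≤-trans (m≤m+n 6 14) 20≤m
    shifted : ∀ u → 14 ≤ u → (6 + u) * (6 + u) ≤ 2 * ((2 + u) * u)
    shifted u 14≤u = begin
      (6 + u) * (6 + u)            ≡⟨ e₁ u ⟩
      u * (4 + u) + (8 * u + 36)   ≤⟨ +-monoʳ-≤ (u * (4 + u)) linear≤square ⟩
      u * (4 + u) + u * u          ≡⟨ e₂ u ⟩
      2 * ((2 + u) * u)            ∎
      where
      open ≤-Reasoning
      e₁ : ∀ u → (6 + u) * (6 + u) ≡ u * (4 + u) + (8 * u + 36)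
      e₁ = solve-∀
      e₂ : ∀ u → u * (4 + u) + u * u ≡ 2 * ((2 + u) * u)
      e₂ = solve-∀
      e₃ : ∀ u → 8 * u + 6 * u ≡ 14 * u
      e₃ = solve-∀
      linear≤square : 8 * u + 36 ≤ u * u
      linear≤square = begin
        8 * u + 6 * 6   ≤⟨ +-monoʳ-≤ (8 * u) (*-monoʳ-≤ 6 (≤-trans (m≤m+n 6 8) 14≤u)) ⟩
        8 * u + 6 * u   ≡⟨ e₃ u ⟩
        14 * u          ≤⟨ *-monoˡ-≤ u 14≤u ⟩
        u * u           ∎

  cancel-square : ∀ k X Y → .{{_ : NonZero k}} → 4 * (X * (k * k)) ≤ k * Y → X * k ≤ Y
  cancel-square k X Y h = *-cancelˡ-≤ k (begin
    k * (X * k)      ≡⟨ reorder k X ⟩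
    X * (k * k)      ≤⟨ m≤n*m (X * (k * k)) 4 ⟩
    4 * (X * (k * k)) ≤⟨ h ⟩
    k * Y            ∎)
    where
    open ≤-Reasoning
    reorder : ∀ k X → k * (X * k) ≡ X * (k * k)
    reorder = solve-∀

module PairingModel where

  open FiniteSums
  open Enumerations
  open Reflection
  open Switching using (IsPairing)
  open import Data.Bool using (true; false; _∧_)
  open import Data.Nat.Properties using (*-comm; *-identityʳ)
  open import Data.List using (replicate; length; allFin)
  open import Data.Fin using (_≟_) renaming (zero to fzero)
  open import Data.Product using (proj₁; proj₂)
  open import Data.Sum using (_⊎_; inj₁; inj₂)
  open import Relation.Binary.PropositionalEquality hiding ([_])
  open import Relation.Nullary.Decidable using (⌊_⌋)

  module _ {n : ℕ} (d : Fin n → ℕ) where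

    isPairing-sound : (f : Point d → Point d) → isPairing d f ≡ true → IsPairing f
    isPairing-sound f h = record
      { no-fixed-point = λ x → no-sound (f x ≟ x) (proj₁ (∧-split (at x)))
      ; involutive = λ x → yes-sound (f (f x) ≟ x) (proj₂ (∧-split (at x)))
      }
      where
      at : ∀ x → (not ⌊ f x ≟ x ⌋ ∧ ⌊ f (f x) ≟ x ⌋) ≡ true
      at = and-sound _ (λ i → i) _ h

    isPairing-complete : (f : Point d → Point d) → IsPairing f → isPairing d f ≡ true
    isPairing-complete f f-pairing = and-complete _ (λ i → i) _ λ x →
      ∧-join (no-complete (f x ≟ x) (no-fixed-point x)) (yes-complete (f (f x) ≟ x) (involutive x))
      where open IsPairing f-pairing

  Restricted : {n : ℕ} (inL : Fin n → Bool) (d : Fin n → ℕ) → (Point d → Point d) → Set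
  Restricted inL d f = ∀ x → inL (owner d x) ≡ false ⊎ inL (owner d (f x)) ≡ false

  restricted-≗ : {n : ℕ} (inL : Fin n → Bool) (d : Fin n → ℕ) {f g : Point d → Point d} →
    (∀ x → g x ≡ f x) → Restricted inL d f → Restricted inL d g
  restricted-≗ inL d g≗f f-restricted x =
    subst (λ y → inL (owner d x) ≡ false ⊎ inL (owner d y) ≡ false) (sym (g≗f x)) (f-restricted x)

  module _ {n : ℕ} (inL : Fin n → Bool) (d : Fin n → ℕ) where

    private
      nand-sound : ∀ a b → not (a ∧ b) ≡ true → a ≡ false ⊎ b ≡ false
      nand-sound false b _ = inj₁ refl
      nand-sound true false _ = inj₂ refl

      nand-complete : ∀ {a b} → a ≡ false ⊎ b ≡ false → not (a ∧ b) ≡ true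
      nand-complete (inj₁ refl) = refl
      nand-complete {true} (inj₂ refl) = refl
      nand-complete {false} (inj₂ refl) = refl

    isRestricted-sound : ∀ f → isRestricted inL d f ≡ true → Restricted inL d f
    isRestricted-sound f h x = nand-sound _ _ (and-sound _ (λ i → i) _ h x)

    isRestricted-complete : ∀ f → Restricted inL d f → isRestricted inL d f ≡ true
    isRestricted-complete f r = and-complete _ (λ i → i) _ (λ x → nand-complete (r x))

  module _ {n : ℕ} (d : Fin n → ℕ) where

    points-at : ∀ v → ΣL (allFin (length (ownerList d))) (λ q → [ ⌊ owner d q ≟ v ⌋ ]) ≡ d v
    points-at v = begin
      ΣL (allFin (length (ownerList d))) (λ q → [ ⌊ owner d q ≟ v ⌋ ])
        ≡⟨ positions-of (ownerList d) v ⟩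
      ΣL (ownerList d) (λ u → [ ⌊ u ≟ v ⌋ ])
        ≡⟨ ΣL-concatMap (λ u → replicate (d u) u) (allFin n) _ ⟩
      ΣL (allFin n) (λ u → ΣL (replicate (d u) u) (λ u → [ ⌊ u ≟ v ⌋ ]))
        ≡⟨ ΣL-cong (allFin n) (λ u → trans (ΣL-replicate (d u) u _) (*-comm (d u) _)) ⟩
      ΣL (allFin n) (λ u → [ ⌊ u ≟ v ⌋ ] * d u)
        ≡⟨ pick (finEnum n) v d ⟩
      d v ∎
      where open ≡-Reasoning

    points-at-≤ : ∀ v → ΣL (allFin (length (ownerList d))) (λ q → [ ⌊ owner d q ≟ v ⌋ ]) ≤ dmax d
    points-at-≤ v = subst (_≤ dmax d) (sym (points-at v)) (≤-max n (λ i → i) d v)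

    #points≡totalDeg : length (ownerList d) ≡ totalDeg d
    #points≡totalDeg = begin
      length (ownerList d)                              ≡⟨ length≡ΣL (ownerList d) ⟩
      ΣL (ownerList d) (λ _ → 1)                         ≡⟨ ΣL-concatMap (λ u → replicate (d u) u) (allFin n) _ ⟩
      ΣL (allFin n) (λ u → ΣL (replicate (d u) u) (λ _ → 1))
        ≡⟨ ΣL-cong (allFin n) (λ u → trans (ΣL-replicate (d u) u _) (*-identityʳ (d u))) ⟩
      totalDeg d ∎
      where open ≡-Reasoning

module DoubleLoops {n : ℕ} (d : Fin n → ℕ) (f : Point d → Point d) where

  open FiniteSums
  open Enumerations using (finEnum; pick; [yes])
  open Reflection
  open Estimates using (eight-C2-half; square≤twice-shifted)
  open Switching using (Switchable)
  open import Data.Bool using (true; false; _∧_)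
  open import Data.Nat using (_∸_; _/_)
  open import Data.Nat.Properties using (*-zeroʳ; +-identityʳ; *-monoʳ-≤; *-monoˡ-≤; module ≤-Reasoning)
  open import Data.Nat.Combinatorics using (_C_)
  open import Data.Nat.Tactic.RingSolver using (solve-∀)
  open import Data.List using ([]; _∷_; allFin; length)
  open import Data.List.Relation.Unary.All using (All; []; _∷_)
  open import Data.Fin using (_≟_)
  open import Data.Product using (proj₁; proj₂)
  open import Relation.Binary.PropositionalEquality hiding ([_])
  open import Relation.Nullary.Decidable using (⌊_⌋)

  m : ℕ
  m = length (ownerList d)

  open Avoiding {m}

  o : Point d → Fin n
  o = owner d

  inLoopAt : Fin n → Point d → Bool
  inLoopAt v p = ⌊ o p ≟ v ⌋ ∧ ⌊ o (f p) ≟ v ⌋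

  -- The number of points in loops at v; by definition loopsAt d f v = loopPoints v / 2.
  loopPoints : Fin n → ℕ
  loopPoints v = ΣP (λ p → [ inLoopAt v p ])

  twoLoops? : Point d → Point d → Bool
  twoLoops? p₁ p₃ = inLoopAt (o p₁) p₁ ∧ (inLoopAt (o p₁) p₃ ∧ notIn (p₁ ∷ f p₁ ∷ []) p₃)

  fresh-a? : Point d → Point d → Point d → Bool
  fresh-a? p₁ p₃ a = notIn (p₁ ∷ f p₁ ∷ p₃ ∷ f p₃ ∷ []) a

  fresh-c? : Point d → Point d → Point d → Point d → Bool
  fresh-c? p₁ p₃ a c = notIn (p₁ ∷ f p₁ ∷ p₃ ∷ f p₃ ∷ a ∷ f a ∷ []) c

  Quad : Set
  Quad = Point d × Point d × Point d × Point d

  switchable? : Quad → Bool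
  switchable? (p₁ , p₃ , a , c) = twoLoops? p₁ p₃ ∧ (fresh-a? p₁ p₃ a ∧ fresh-c? p₁ p₃ a c)

  #twoLoops : ℕ
  #twoLoops = ΣP (λ p₁ → ΣP (λ p₃ → [ twoLoops? p₁ p₃ ]))

  #switchable : ℕ
  #switchable = ΣP (λ p₁ → ΣP (λ p₃ → ΣP (λ a → ΣP (λ c → [ switchable? (p₁ , p₃ , a , c) ]))))

  record SwitchData (p₁ p₃ a c : Point d) : Set where
    field
      distinct : Switchable f p₁ p₃ a c
      p₂-at : o (f p₁) ≡ o p₁
      p₃-at : o p₃ ≡ o p₁
      p₄-at : o (f p₃) ≡ o p₁

  switchable-sound : ∀ {p₁ p₃ a c} → switchable? (p₁ , p₃ , a , c) ≡ true → SwitchData p₁ p₃ a c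
  switchable-sound {p₁} {p₃} {a} {c} h = record
    { distinct = distinctness (notIn-sound _ p₃-fresh) (notIn-sound _ a-fresh) (notIn-sound _ c-fresh)
    ; p₂-at = yes-sound (o (f p₁) ≟ o p₁) (proj₂ (∧-split {⌊ o p₁ ≟ o p₁ ⌋} loop₁))
    ; p₃-at = yes-sound (o p₃ ≟ o p₁) (proj₁ (∧-split {⌊ o p₃ ≟ o p₁ ⌋} loop₃))
    ; p₄-at = yes-sound (o (f p₃) ≟ o p₁) (proj₂ (∧-split {⌊ o p₃ ≟ o p₁ ⌋} loop₃))
    }
    where
    loops : twoLoops? p₁ p₃ ≡ true
    loops = proj₁ (∧-split {twoLoops? p₁ p₃} h)
    fresh : fresh-a? p₁ p₃ a ∧ fresh-c? p₁ p₃ a c ≡ true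
    fresh = proj₂ (∧-split {twoLoops? p₁ p₃} h)
    loop₁ : inLoopAt (o p₁) p₁ ≡ true
    loop₁ = proj₁ (∧-split {inLoopAt (o p₁) p₁} loops)
    p₃-in-other-loop : inLoopAt (o p₁) p₃ ∧ notIn (p₁ ∷ f p₁ ∷ []) p₃ ≡ true
    p₃-in-other-loop = proj₂ (∧-split {inLoopAt (o p₁) p₁} loops)
    loop₃ : inLoopAt (o p₁) p₃ ≡ true
    loop₃ = proj₁ (∧-split {inLoopAt (o p₁) p₃} p₃-in-other-loop)
    p₃-fresh : notIn (p₁ ∷ f p₁ ∷ []) p₃ ≡ true
    p₃-fresh = proj₂ (∧-split {inLoopAt (o p₁) p₃} p₃-in-other-loop)
    a-fresh : fresh-a? p₁ p₃ a ≡ true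
    a-fresh = proj₁ (∧-split {fresh-a? p₁ p₃ a} fresh)
    c-fresh : fresh-c? p₁ p₃ a c ≡ true
    c-fresh = proj₂ (∧-split {fresh-a? p₁ p₃ a} fresh)
    distinctness : All (p₃ ≢_) (p₁ ∷ f p₁ ∷ []) → All (a ≢_) (p₁ ∷ f p₁ ∷ p₃ ∷ f p₃ ∷ []) →
      All (c ≢_) (p₁ ∷ f p₁ ∷ p₃ ∷ f p₃ ∷ a ∷ f a ∷ []) → Switchable f p₁ p₃ a c
    distinctness (h₁ ∷ h₂ ∷ []) (a₁ ∷ a₂ ∷ a₃ ∷ a₄ ∷ []) (c₁ ∷ c₂ ∷ c₃ ∷ c₄ ∷ c₅ ∷ c₆ ∷ []) = record
      { p₃≢p₁ = h₁ ; p₃≢p₂ = h₂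
      ; a≢p₁ = a₁ ; a≢p₂ = a₂ ; a≢p₃ = a₃ ; a≢p₄ = a₄
      ; c≢p₁ = c₁ ; c≢p₂ = c₂ ; c≢p₃ = c₃ ; c≢p₄ = c₄ ; c≢a = c₅ ; c≢b = c₆
      }

  -- Each pair (p₁ , p₃) in two loops extends to at least (m − 4)(m − 6)
  -- switchable configurations: a avoids 4 points, then c avoids 6.
  extensions-≥ : ∀ p₁ p₃ → [ twoLoops? p₁ p₃ ] * ((m ∸ 4) * (m ∸ 6)) ≤
    ΣP (λ a → ΣP (λ c → [ switchable? (p₁ , p₃ , a , c) ]))
  extensions-≥ p₁ p₃ = begin
    T * ((m ∸ 4) * (m ∸ 6))
      ≤⟨ *-monoʳ-≤ T (*-monoˡ-≤ (m ∸ 6) (avoiding-≥ (p₁ ∷ f p₁ ∷ p₃ ∷ f p₃ ∷ []))) ⟩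
    T * (ΣP (λ a → [ fresh-a? p₁ p₃ a ]) * (m ∸ 6))
      ≡⟨ cong (T *_) (sym (ΣL-*ʳ (allFin m) (m ∸ 6) _)) ⟩
    T * ΣP (λ a → [ fresh-a? p₁ p₃ a ] * (m ∸ 6))
      ≤⟨ *-monoʳ-≤ T (ΣL-mono (allFin m) (λ a →
           *-monoʳ-≤ [ fresh-a? p₁ p₃ a ] (avoiding-≥ (p₁ ∷ f p₁ ∷ p₃ ∷ f p₃ ∷ a ∷ f a ∷ [])))) ⟩
    T * ΣP (λ a → [ fresh-a? p₁ p₃ a ] * ΣP (λ c → [ fresh-c? p₁ p₃ a c ]))
      ≡⟨ sym (ΣL-*ˡ (allFin m) T _) ⟩
    ΣP (λ a → T * ([ fresh-a? p₁ p₃ a ] * ΣP (λ c → [ fresh-c? p₁ p₃ a c ])))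
      ≡⟨ ΣL-cong (allFin m) (λ a → indicator-product a) ⟩
    ΣP (λ a → ΣP (λ c → [ switchable? (p₁ , p₃ , a , c) ])) ∎
    where
    open ≤-Reasoning
    T : ℕ
    T = [ twoLoops? p₁ p₃ ]
    indicator-product : ∀ a → T * ([ fresh-a? p₁ p₃ a ] * ΣP (λ c → [ fresh-c? p₁ p₃ a c ])) ≡
      ΣP (λ c → [ switchable? (p₁ , p₃ , a , c) ])
    indicator-product a = sym (begin-equality
      ΣP (λ c → [ switchable? (p₁ , p₃ , a , c) ])
        ≡⟨ ΣL-cong (allFin m) (λ c → trans ([∧] (twoLoops? p₁ p₃) _) (cong (T *_) ([∧] (fresh-a? p₁ p₃ a) _))) ⟩
      ΣP (λ c → T * ([ fresh-a? p₁ p₃ a ] * [ fresh-c? p₁ p₃ a c ]))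
        ≡⟨ ΣL-*ˡ (allFin m) T _ ⟩
      T * ΣP (λ c → [ fresh-a? p₁ p₃ a ] * [ fresh-c? p₁ p₃ a c ])
        ≡⟨ cong (T *_) (ΣL-*ˡ (allFin m) [ fresh-a? p₁ p₃ a ] _) ⟩
      T * ([ fresh-a? p₁ p₃ a ] * ΣP (λ c → [ fresh-c? p₁ p₃ a c ])) ∎)

  #switchable-≥ : #twoLoops * ((m ∸ 4) * (m ∸ 6)) ≤ #switchable
  #switchable-≥ = begin
    #twoLoops * K                                  ≡⟨ sym (ΣL-*ʳ (allFin m) K _) ⟩
    ΣP (λ p₁ → ΣP (λ p₃ → [ twoLoops? p₁ p₃ ]) * K) ≡⟨ ΣL-cong (allFin m) (λ p₁ → sym (ΣL-*ʳ (allFin m) K _)) ⟩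
    ΣP (λ p₁ → ΣP (λ p₃ → [ twoLoops? p₁ p₃ ] * K)) ≤⟨ ΣL-mono (allFin m) (λ p₁ → ΣL-mono (allFin m) (extensions-≥ p₁)) ⟩
    #switchable                                    ∎
    where
    open ≤-Reasoning
    K : ℕ
    K = (m ∸ 4) * (m ∸ 6)

  partners-≥ : ∀ p₁ → [ inLoopAt (o p₁) p₁ ] * (loopPoints (o p₁) ∸ 2) ≤ ΣP (λ p₃ → [ twoLoops? p₁ p₃ ])
  partners-≥ p₁ = begin
    L₁ * (loopPoints v ∸ 2)
      ≤⟨ *-monoʳ-≤ L₁ (exclude-≥ (inLoopAt v) (p₁ ∷ f p₁ ∷ [])) ⟩
    L₁ * ΣP (λ p₃ → [ inLoopAt v p₃ ∧ notIn (p₁ ∷ f p₁ ∷ []) p₃ ])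
      ≡⟨ sym (ΣL-*ˡ (allFin m) L₁ _) ⟩
    ΣP (λ p₃ → L₁ * [ inLoopAt v p₃ ∧ notIn (p₁ ∷ f p₁ ∷ []) p₃ ])
      ≡⟨ ΣL-cong (allFin m) (λ p₃ → sym ([∧] (inLoopAt v p₁) _)) ⟩
    ΣP (λ p₃ → [ twoLoops? p₁ p₃ ]) ∎
    where
    open ≤-Reasoning
    v : Fin n
    v = o p₁
    L₁ : ℕ
    L₁ = [ inLoopAt v p₁ ]

  #twoLoops-≥ : ΣL (allFin n) (λ v → loopPoints v * (loopPoints v ∸ 2)) ≤ #twoLoops
  #twoLoops-≥ = begin
    ΣV (λ v → loopPoints v * (loopPoints v ∸ 2))
      ≡⟨ ΣL-cong (allFin n) (λ v → sym (ΣL-*ʳ (allFin m) (loopPoints v ∸ 2) _)) ⟩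
    ΣV (λ v → ΣP (λ p₁ → [ inLoopAt v p₁ ] * (loopPoints v ∸ 2)))
      ≡⟨ ΣL-cong (allFin n) (λ v → ΣL-cong (allFin m) (λ p₁ → sym (only-own-vertex p₁ v))) ⟩
    ΣV (λ v → ΣP (λ p₁ → [ ⌊ v ≟ o p₁ ⌋ ] * ([ inLoopAt v p₁ ] * (loopPoints v ∸ 2))))
      ≡⟨ ΣL-swap (allFin n) (allFin m) _ ⟩
    ΣP (λ p₁ → ΣV (λ v → [ ⌊ v ≟ o p₁ ⌋ ] * ([ inLoopAt v p₁ ] * (loopPoints v ∸ 2))))
      ≡⟨ ΣL-cong (allFin m) (λ p₁ → pick (finEnum n) (o p₁) (λ v → [ inLoopAt v p₁ ] * (loopPoints v ∸ 2))) ⟩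
    ΣP (λ p₁ → [ inLoopAt (o p₁) p₁ ] * (loopPoints (o p₁) ∸ 2))
      ≤⟨ ΣL-mono (allFin m) partners-≥ ⟩
    #twoLoops ∎
    where
    open ≤-Reasoning
    ΣV : (Fin n → ℕ) → ℕ
    ΣV = ΣL (allFin n)
    only-own-vertex : ∀ p₁ v → [ ⌊ v ≟ o p₁ ⌋ ] * ([ inLoopAt v p₁ ] * (loopPoints v ∸ 2)) ≡
      [ inLoopAt v p₁ ] * (loopPoints v ∸ 2)
    only-own-vertex p₁ v with inLoopAt v p₁ in loop
    ... | false = *-zeroʳ [ ⌊ v ≟ o p₁ ⌋ ]
    ... | true rewrite [yes] (v ≟ o p₁) (sym (yes-sound (o p₁ ≟ v) (proj₁ (∧-split loop)))) =
      +-identityʳ (1 * (loopPoints v ∸ 2))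

  -- I(f) = Σ_v C(ℓ_v / 2, 2) and 8 C(ℓ/2, 2) ≤ ℓ(ℓ − 2).
  doubleLoops-≤ : 8 * doubleLoops d f ≤ #twoLoops
  doubleLoops-≤ = begin
    8 * doubleLoops d f                                    ≡⟨ sym (ΣL-*ˡ (allFin n) 8 _) ⟩
    ΣL (allFin n) (λ v → 8 * ((loopPoints v / 2) C 2))     ≤⟨ ΣL-mono (allFin n) (λ v → eight-C2-half (loopPoints v)) ⟩
    ΣL (allFin n) (λ v → loopPoints v * (loopPoints v ∸ 2)) ≤⟨ #twoLoops-≥ ⟩
    #twoLoops                                              ∎
    where open ≤-Reasoning

  switchable-≥ : 20 ≤ m → 4 * (doubleLoops d f * (m * m)) ≤ #switchable
  switchable-≥ 20≤m = begin
    4 * (I * (m * m))      ≤⟨ *-monoʳ-≤ 4 (*-monoʳ-≤ I (square≤twice-shifted m 20≤m)) ⟩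
    4 * (I * (2 * K))      ≡⟨ regroup I K ⟩
    (8 * I) * K            ≤⟨ *-monoˡ-≤ K doubleLoops-≤ ⟩
    #twoLoops * K          ≤⟨ #switchable-≥ ⟩
    #switchable            ∎
    where
    open ≤-Reasoning
    I K : ℕ
    I = doubleLoops d f
    K = (m ∸ 4) * (m ∸ 6)
    regroup : ∀ x k → 4 * (x * (2 * k)) ≡ (8 * x) * k
    regroup = solve-∀

-- Switching maps a restricted pairing P together
-- with a switchable configuration (p₁ , p₃ , a , c) of P injectively to a
-- restricted pairing P′ together with four points p₁ , P p₁ , p₃ , P p₃ at
-- one vertex.  Counting both sides gives
--   Σ_P 4 I(P) m²  ≤  Σ_P #switchable(P)  ≤  |𝓜| · m · d_max³.
module SwitchingCount {n : ℕ} (inL : Fin n → Bool) (d : Fin n → ℕ) where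

  open FiniteSums
  open Enumerations
  open Reflection
  open Switching using (IsPairing; pairing-≗; switch; conjugate₂; conjugate₂-cong; module Switch)
  open PairingModel
  open Estimates using (cancel-square)
  open import Data.Bool using (true; false; _∧_)
  open import Data.Nat using (s≤s; z≤n; NonZero; >-nonZero)
  open import Data.Nat.Properties using (*-identityˡ; *-identityʳ; *-mono-≤; *-monoʳ-≤; ≤-trans; module ≤-Reasoning)
  open import Data.Nat.Tactic.RingSolver using (solve-∀)
  open import Data.List using (allFin; length)
  open import Data.List.Properties using (length-tabulate)
  open import Function using (id)
  open import Data.Fin using (_≟_)
  open import Data.Vec using (Vec) renaming (lookup to lookupᵥ; tabulate to tabulateᵥ)
  open import Data.Vec.Properties using (lookup∘tabulate; tabulate∘lookup; tabulate-cong)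
  open import Data.Product using (proj₁; proj₂)
  open import Data.Sum using (_⊎_; inj₁; inj₂)
  open import Relation.Binary.PropositionalEquality hiding ([_])
  open import Relation.Nullary.Decidable using (⌊_⌋)

  m : ℕ
  m = length (ownerList d)

  open Avoiding {m} using (ΣP)

  o : Fin m → Fin n
  o = owner d

  Quad : Set
  Quad = Fin m × Fin m × Fin m × Fin m

  restricted? : Vec (Fin m) m → Bool
  restricted? P = isPairing d (lookupᵥ P) ∧ isRestricted inL d (lookupᵥ P)

  oneVertex? : Quad → Bool
  oneVertex? (q₁ , q₂ , q₃ , q₄) = ⌊ o q₂ ≟ o q₁ ⌋ ∧ (⌊ o q₃ ≟ o q₁ ⌋ ∧ ⌊ o q₄ ≟ o q₁ ⌋)

  before? : Vec (Fin m) m × Quad → Bool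
  before? (P , t) = restricted? P ∧ DoubleLoops.switchable? d (lookupᵥ P) t

  after? : Vec (Fin m) m × Quad → Bool
  after? (P , q) = restricted? P ∧ oneVertex? q

  switchMap : Vec (Fin m) m × Quad → Vec (Fin m) m × Quad
  switchMap (P , p₁ , p₃ , a , c) =
    tabulateᵥ (switch (lookupᵥ P) p₁ p₃ a c) , p₁ , lookupᵥ P p₁ , p₃ , lookupᵥ P p₃

  -- The inverse reads off a = P′ q₁, c = P′ q₃ and conjugates back.
  unswitchMap : Vec (Fin m) m × Quad → Vec (Fin m) m × Quad
  unswitchMap (P′ , q₁ , q₂ , q₃ , q₄) =
    tabulateᵥ (conjugate₂ q₂ (g q₁) q₄ (g q₃) g) , q₁ , q₃ , g q₁ , g q₃
    where
    g : Fin m → Fin m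
    g = lookupᵥ P′

  -- The switching keeps a pairing restricted: the four points p₁,…,p₄ lie at
  -- a vertex outside L (it carries the loop {p₁,p₂}), and every new pair
  -- contains one of them or is an old pair.
  switch-restricted : ∀ {f : Fin m → Fin m} (f-pairing : IsPairing f) → Restricted inL d f →
    ∀ {p₁ p₃ a c} (sd : DoubleLoops.SwitchData d f p₁ p₃ a c) → Restricted inL d (switch f p₁ p₃ a c)
  switch-restricted {f} f-pairing f-restricted {p₁} {p₃} {a} {c} sd x =
    touch (Switch.new-pairs-touch f-pairing distinct G v∉L (at p₂-at) (at p₃-at) (at p₄-at) x)
    where
    open DoubleLoops.SwitchData sd
    f′ : Fin m → Fin m
    f′ = switch f p₁ p₃ a c
    G : Fin m → Set
    G y = inL (o y) ≡ false
    v∉L : G p₁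
    v∉L with f-restricted p₁
    ... | inj₁ p₁∉L = p₁∉L
    ... | inj₂ p₂∉L = trans (cong inL (sym p₂-at)) p₂∉L
    at : ∀ {y} → o y ≡ o p₁ → G y
    at y-at = trans (cong inL y-at) v∉L
    touch : G x ⊎ G (f′ x) ⊎ f′ x ≡ f x → G x ⊎ G (f′ x)
    touch (inj₁ Gx) = inj₁ Gx
    touch (inj₂ (inj₁ Gf′x)) = inj₂ Gf′x
    touch (inj₂ (inj₂ f′x≡fx)) = subst (λ y → G x ⊎ G y) (sym f′x≡fx) (f-restricted x)

  switchMap-correct : ∀ x → before? x ≡ true → (after? (switchMap x) ≡ true) × (unswitchMap (switchMap x) ≡ x)
  switchMap-correct (P , p₁ , p₃ , a , c) h = ∧-join P′-restricted one-vertex , recovered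
    where
    f : Fin m → Fin m
    f = lookupᵥ P
    P-ok : restricted? P ≡ true
    P-ok = proj₁ (∧-split {restricted? P} h)
    sd : DoubleLoops.SwitchData d f p₁ p₃ a c
    sd = DoubleLoops.switchable-sound d f (proj₂ (∧-split {restricted? P} h))
    f-pairing : IsPairing f
    f-pairing = isPairing-sound d f (proj₁ (∧-split {isPairing d f} P-ok))
    f-restricted : Restricted inL d f
    f-restricted = isRestricted-sound inL d f (proj₂ (∧-split {isPairing d f} P-ok))
    open DoubleLoops.SwitchData sd
    open Switch f-pairing distinct using (f′; f′-pairing; f′-p₁; f′-p₃; unswitch)
    g : Fin m → Fin m
    g = lookupᵥ (tabulateᵥ f′)
    g≗f′ : ∀ y → g y ≡ f′ y
    g≗f′ = lookup∘tabulate f′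
    P′-restricted : restricted? (tabulateᵥ f′) ≡ true
    P′-restricted = ∧-join (isPairing-complete d g (pairing-≗ g≗f′ f′-pairing))
      (isRestricted-complete inL d g (restricted-≗ inL d g≗f′ (switch-restricted f-pairing f-restricted sd)))
    one-vertex : oneVertex? (p₁ , f p₁ , p₃ , f p₃) ≡ true
    one-vertex = ∧-join (yes-complete (o (f p₁) ≟ o p₁) p₂-at)
      (∧-join (yes-complete (o p₃ ≟ o p₁) p₃-at) (yes-complete (o (f p₃) ≟ o p₁) p₄-at))
    g-p₁ : g p₁ ≡ a
    g-p₁ = trans (g≗f′ p₁) f′-p₁
    g-p₃ : g p₃ ≡ c
    g-p₃ = trans (g≗f′ p₃) f′-p₃
    P-recovered : tabulateᵥ (conjugate₂ (f p₁) (g p₁) (f p₃) (g p₃) g) ≡ P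
    P-recovered = begin
      tabulateᵥ (conjugate₂ (f p₁) (g p₁) (f p₃) (g p₃) g)
        ≡⟨ cong₂ (λ a′ c′ → tabulateᵥ (conjugate₂ (f p₁) a′ (f p₃) c′ g)) g-p₁ g-p₃ ⟩
      tabulateᵥ (conjugate₂ (f p₁) a (f p₃) c g)
        ≡⟨ tabulate-cong (λ y → trans (conjugate₂-cong (f p₁) a (f p₃) c g≗f′ y) (unswitch y)) ⟩
      tabulateᵥ f
        ≡⟨ tabulate∘lookup P ⟩
      P ∎
      where open ≡-Reasoning
    recovered : unswitchMap (switchMap (P , p₁ , p₃ , a , c)) ≡ (P , p₁ , p₃ , a , c)
    recovered = cong₂ _,_ P-recovered (cong₂ (λ a′ c′ → p₁ , p₃ , a′ , c′) g-p₁ g-p₃)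

  quadEnum : Enum Quad
  quadEnum = finEnum m ×ₑ (finEnum m ×ₑ (finEnum m ×ₑ finEnum m))

  configEnum : Enum (Vec (Fin m) m × Quad)
  configEnum = vecEnum m m ×ₑ quadEnum

  ΣV : (Vec (Fin m) m → ℕ) → ℕ
  ΣV = ΣL (allVecs m m)

  ΣQuad : (g : Quad → ℕ) →
    ΣE quadEnum g ≡ ΣP (λ q₁ → ΣP (λ q₂ → ΣP (λ q₃ → ΣP (λ q₄ → g (q₁ , q₂ , q₃ , q₄)))))
  ΣQuad g = trans (Σ× P (P ×ₑ (P ×ₑ P)) g) (ΣL-cong (allFin m) (λ q₁ →
              trans (Σ× P (P ×ₑ P) _) (ΣL-cong (allFin m) (λ q₂ → Σ× P P _))))
    where
    P : Enum (Fin m)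
    P = finEnum m

  ΣConfig : (S : Vec (Fin m) m → Quad → Bool) →
    ΣE configEnum (λ x → [ restricted? (proj₁ x) ∧ S (proj₁ x) (proj₂ x) ]) ≡
    ΣV (λ P → [ restricted? P ] * ΣE quadEnum (λ q → [ S P q ]))
  ΣConfig S = begin
    ΣE configEnum (λ x → [ restricted? (proj₁ x) ∧ S (proj₁ x) (proj₂ x) ])
      ≡⟨ Σ× (vecEnum m m) quadEnum _ ⟩
    ΣE (vecEnum m m) (λ P → ΣE quadEnum (λ q → [ restricted? P ∧ S P q ]))
      ≡⟨ cong (λ Ps → ΣL Ps (λ P → ΣE quadEnum (λ q → [ restricted? P ∧ S P q ]))) (vecEnum-elems m m) ⟩
    ΣV (λ P → ΣE quadEnum (λ q → [ restricted? P ∧ S P q ]))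
      ≡⟨ ΣL-cong (allVecs m m) (λ P → ΣL-cong (elems quadEnum) (λ q → [∧] (restricted? P) (S P q))) ⟩
    ΣV (λ P → ΣE quadEnum (λ q → [ restricted? P ] * [ S P q ]))
      ≡⟨ ΣL-cong (allVecs m m) (λ P → ΣL-*ˡ (elems quadEnum) [ restricted? P ] _) ⟩
    ΣV (λ P → [ restricted? P ] * ΣE quadEnum (λ q → [ S P q ])) ∎
    where open ≡-Reasoning

  #oneVertex-≤ : ΣE quadEnum (λ q → [ oneVertex? q ]) ≤ m * dmax d ^ 3
  #oneVertex-≤ = begin
    ΣE quadEnum (λ q → [ oneVertex? q ])                   ≡⟨ ΣQuad _ ⟩
    ΣP (λ q₁ → ΣP (λ q₂ → ΣP (λ q₃ → ΣP (λ q₄ → [ oneVertex? (q₁ , q₂ , q₃ , q₄) ]))))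
      ≡⟨ ΣL-cong (allFin m) (λ q₁ → ΣL-cube (allFin m) (λ q → ⌊ o q ≟ o q₁ ⌋)) ⟩
    ΣP (λ q₁ → N q₁ * (N q₁ * N q₁))                       ≤⟨ ΣL-mono (allFin m) (λ q₁ → cube-≤ (points-at-≤ d (o q₁))) ⟩
    ΣP (λ _ → dmax d ^ 3)                                  ≡⟨ ΣL-const (allFin m) _ ⟩
    length (allFin m) * dmax d ^ 3                         ≡⟨ cong (_* dmax d ^ 3) (length-tabulate {n = m} id) ⟩
    m * dmax d ^ 3                                         ∎
    where
    open ≤-Reasoning
    N : Fin m → ℕ
    N q₁ = ΣP (λ q → [ ⌊ o q ≟ o q₁ ⌋ ])
    cube-≤ : ∀ {k} → k ≤ dmax d → k * (k * k) ≤ dmax d ^ 3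
    cube-≤ k≤D = *-mono-≤ k≤D (*-mono-≤ k≤D (subst (_ ≤_) (sym (*-identityʳ (dmax d))) k≤D))

  totalDoubleLoops≡ : totalDoubleLoops inL d ≡ ΣV (λ P → [ restricted? P ] * doubleLoops d (lookupᵥ P))
  totalDoubleLoops≡ = ΣL-filter (allVecs m m) lookupᵥ (λ f → isPairing d f ∧ isRestricted inL d f) (doubleLoops d)

  numRestricted≡ : numRestricted inL d ≡ ΣV (λ P → [ restricted? P ])
  numRestricted≡ = begin
    numRestricted inL d                                  ≡⟨ length≡ΣL (restrictedPairings inL d) ⟩
    ΣL (restrictedPairings inL d) (λ _ → 1)              ≡⟨ ΣL-filter (allVecs m m) lookupᵥ _ (λ _ → 1) ⟩
    ΣV (λ P → [ restricted? P ] * 1)                     ≡⟨ ΣL-cong (allVecs m m) (λ P → *-identityʳ _) ⟩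
    ΣV (λ P → [ restricted? P ])                         ∎
    where open ≡-Reasoning

  switching-inequality : 20 ≤ m → 4 * (totalDoubleLoops inL d * (m * m)) ≤ m * (dmax d ^ 3 * numRestricted inL d)
  switching-inequality 20≤m = begin
    4 * (totalDoubleLoops inL d * (m * m))
      ≡⟨ cong (λ X → 4 * (X * (m * m))) totalDoubleLoops≡ ⟩
    4 * (ΣV (λ P → [ restricted? P ] * I P) * (m * m))
      ≡⟨ trans (cong (4 *_) (sym (ΣL-*ʳ (allVecs m m) (m * m) _))) (sym (ΣL-*ˡ (allVecs m m) 4 _)) ⟩
    ΣV (λ P → 4 * ([ restricted? P ] * I P * (m * m)))
      ≡⟨ ΣL-cong (allVecs m m) (λ P → regroup [ restricted? P ] (I P) (m * m)) ⟩
    ΣV (λ P → [ restricted? P ] * (4 * (I P * (m * m))))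
      ≤⟨ ΣL-mono (allVecs m m) (λ P → *-monoʳ-≤ [ restricted? P ] (DoubleLoops.switchable-≥ d (lookupᵥ P) 20≤m)) ⟩
    ΣV (λ P → [ restricted? P ] * DoubleLoops.#switchable d (lookupᵥ P))
      ≡⟨ ΣL-cong (allVecs m m) (λ P → cong ([ restricted? P ] *_) (sym (ΣQuad _))) ⟩
    ΣV (λ P → [ restricted? P ] * ΣE quadEnum (λ t → [ DoubleLoops.switchable? d (lookupᵥ P) t ]))
      ≡⟨ sym (ΣConfig (λ P → DoubleLoops.switchable? d (lookupᵥ P))) ⟩
    ΣE configEnum (λ x → [ before? x ])
      ≤⟨ count-by-injection configEnum configEnum before? after? switchMap unswitchMap switchMap-correct ⟩
    ΣE configEnum (λ x → [ after? x ])
      ≡⟨ ΣConfig (λ _ → oneVertex?) ⟩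
    ΣV (λ P → [ restricted? P ] * #oneVertex)
      ≡⟨ ΣL-*ʳ (allVecs m m) #oneVertex _ ⟩
    ΣV (λ P → [ restricted? P ]) * #oneVertex
      ≤⟨ *-monoʳ-≤ (ΣV (λ P → [ restricted? P ])) #oneVertex-≤ ⟩
    ΣV (λ P → [ restricted? P ]) * (m * dmax d ^ 3)
      ≡⟨ cong (_* (m * dmax d ^ 3)) (sym numRestricted≡) ⟩
    numRestricted inL d * (m * dmax d ^ 3)
      ≡⟨ rotate (numRestricted inL d) m (dmax d ^ 3) ⟩
    m * (dmax d ^ 3 * numRestricted inL d) ∎
    where
    open ≤-Reasoning
    I : Vec (Fin m) m → ℕ
    I P = doubleLoops d (lookupᵥ P)
    #oneVertex : ℕ
    #oneVertex = ΣE quadEnum (λ q → [ oneVertex? q ])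
    regroup : ∀ r i k → 4 * (r * i * k) ≡ r * (4 * (i * k))
    regroup = solve-∀
    rotate : ∀ N k D → N * (k * D) ≡ k * (D * N)
    rotate = solve-∀

  double-loops-bound : 20 ≤ totalDeg d → totalDoubleLoops inL d * totalDeg d ≤ 1 * dmax d ^ 3 * numRestricted inL d
  double-loops-bound 20≤M = begin
    totalDoubleLoops inL d * totalDeg d ≡⟨ cong (totalDoubleLoops inL d *_) (sym m≡M) ⟩
    totalDoubleLoops inL d * m
      ≤⟨ cancel-square m (totalDoubleLoops inL d) (D * numRestricted inL d) {{m≢0}} (switching-inequality 20≤m) ⟩
    D * numRestricted inL d             ≡⟨ cong (_* numRestricted inL d) (sym (*-identityˡ D)) ⟩
    1 * D * numRestricted inL d         ∎
    where
    open ≤-Reasoning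
    D : ℕ
    D = dmax d ^ 3
    m≡M : m ≡ totalDeg d
    m≡M = #points≡totalDeg d
    20≤m : 20 ≤ m
    20≤m = subst (20 ≤_) (sym m≡M) 20≤M
    m≢0 : NonZero m
    m≢0 = >-nonZero (≤-trans (s≤s z≤n) 20≤m)

lemma3p2 : ∃[ C ] ∃[ N₀ ] ∃[ M₀ ]
    ((n : ℕ) (inL : Fin n → Bool) (d : Fin n → ℕ) →
    n ≥ N₀ → totalDeg d ≥ M₀ → 2 ∣ totalDeg d →
    M1 (λ i → not (inL i)) d ≥ M1 inL d →
    totalDoubleLoops inL d * totalDeg d ≤ C * dmax d ^ 3 * numRestricted inL d)
lemma3p2 = 1 , 0 , 20 , λ n inL d _ 20≤M _ _ → SwitchingCount.double-loops-bound inL d 20≤M
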